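{- Let $G=(V,E)$ be a graph with at least one edge. The following are equivalent: (1) $G$ is uniformly dense. (2) $\operatorname{rank}(L(G))-\operatorname{rank}(L(G|A))\le \dfrac{|E|-|A|}{\rho(G)}$ for all nonempty $A\subseteq E$. (3) $\dfrac{n_0(L^1(G|A))}{|A|}\le\dfrac{n_0(L^1(G))}{|E|}$ for all nonempty $A\subseteq E$.
   Context: Graphs are finite and simple. $c(A)$ is the number of connected components of $(V,A)$, $\operatorname{rank}(A)=|V|-c(A)$ (matroid rank), $\rho(A)=|A|/\operatorname{rank}(A)$, $\rho(G)=\rho(E)$; $G$ is uniformly dense if $\rho(A)\le\rho(E)$ for all nonempty $A$. For $A\subseteq E$, $G|A$ is the graph $(V,A)$ with all isolated vertices removed. For a graph $H$ without isolated vertices, the normalized Laplacian $L(H)$ acts on $f:V(H)\to\mathbb{R}$ by $Lf(v)=f(v)-\frac{1}{\deg v}\sum_{u\sim v}f(u)$; $\operatorname{rank}(L(H))$ is its linear-algebraic rank. Fixing an orientation (input and output endpoint) of each edge, the edge Laplacian $L^1(H)$ acts on $\gamma:E(H)\to\mathbb{R}$ by $L^1\gamma(e)=\frac{1}{\deg v}\big(\sum_{e_1:\,v\text{ input}}\gamma(e_1)-\sum_{e_2:\,v\text{ output}}\gamma(e_2)\big)-\frac{1}{\deg w}\big(\sum_{e_1':\,w\text{ input}}\gamma(e_1')-\sum_{e_2':\,w\text{ output}}\gamma(e_2')\big)$ for $e$ with input $v$ and output $w$. $n_0(\cdot)$ denotes the multiplicity of $0$ as an eigenvalue. -}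

module Defs where

open import Data.Nat as ℕ using (ℕ; zero; suc; _≤_; _∸_)
open import Data.Integer as ℤ using (ℤ; +_)
open import Data.Rational as ℚ using (ℚ; 0ℚ; 1ℚ; _/_; _+_; _*_; _-_; -_)
open import Data.Fin using (Fin; zero; suc; _≟_)
open import Data.Fin.Subset using (Subset; _∈_; ⊤; ∣_∣; Nonempty)
open import Data.Bool using (Bool; true; false; if_then_else_; _∧_; _∨_)
open import Data.Vec using (lookup)
open import Data.Product using (Σ; ∃; _×_; _,_)
open import Data.Sum using (_⊎_)
open import Relation.Nullary using (¬_; does)
open import Relation.Binary.PropositionalEquality using (_≡_; _≢_)
open import Function.Bundles using (_⇔_)

-- A finite simple graph on vertex set Fin n with m edges; each edge e is
-- given a fixed orientation: input endpoint src e, output endpoint tgt e.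
record Graph : Set where
  field
    n m       : ℕ
    src tgt   : Fin m → Fin n
    loopless  : ∀ e → src e ≢ tgt e
    noMulti   : ∀ e e' → ((src e ≡ src e' × tgt e ≡ tgt e') ⊎ (src e ≡ tgt e' × tgt e ≡ src e')) → e ≡ e'
open Graph public

EdgeSet : Graph → Set
EdgeSet G = Subset (m G)

data Reach (G : Graph) (A : EdgeSet G) : Fin (n G) → Fin (n G) → Set where
  here : ∀ {v} → Reach G A v v
  step : ∀ {u v w} (e : Fin (m G)) → e ∈ A →
         ((src G e ≡ u × tgt G e ≡ v) ⊎ (src G e ≡ v × tgt G e ≡ u)) →
         Reach G A v w → Reach G A u w

HasComponents : (G : Graph) → EdgeSet G → ℕ → Set
HasComponents G A k =
  Σ (Fin (n G) → Fin k) λ f →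
    (∀ (i : Fin k) → ∃ λ v → f v ≡ i) ×
    (∀ u v → (f u ≡ f v) ⇔ Reach G A u v)

-- matroid rank: rank(A) = |V| - c(A)  (in terms of c(A) = k)
mrank : Graph → ℕ → ℕ
mrank G k = n G ∸ k

sumFin : ∀ {r} → (Fin r → ℚ) → ℚ
sumFin {zero}  f = 0ℚ
sumFin {suc r} f = f zero + sumFin (λ k → f (suc k))

LinIndep : ∀ {I : Set} {r} → (Fin r → I → ℚ) → Set
LinIndep {I} {r} c =
  ∀ (a : Fin r → ℚ) → (∀ (i : I) → sumFin (λ k → a k * c k i) ≡ 0ℚ) → ∀ k → a k ≡ 0ℚ

HasRank : ∀ {I J : Set} → (I → J → ℚ) → ℕ → Set
HasRank {I} {J} M r =
  (Σ (Fin r → J) λ s → LinIndep (λ k i → M i (s k))) ×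
  (∀ (s : Fin (suc r) → J) → ¬ LinIndep (λ k i → M i (s k)))

ℕtoℚ : ℕ → ℚ
ℕtoℚ k = + k / 1

-- 1/d for d > 0 (only ever used at positive degrees); 0 at d = 0
inv : ℕ → ℚ
inv zero    = 0ℚ
inv (suc d) = + 1 / suc d

countFin : ∀ {r} → (Fin r → Bool) → ℕ
countFin {zero}  p = 0
countFin {suc r} p = (if p zero then 1 else 0) ℕ.+ countFin (λ k → p (suc k))

eqb : ∀ {k} → Fin k → Fin k → Bool
eqb x y = does (x ≟ y)

degA : (G : Graph) → EdgeSet G → Fin (n G) → ℕ
degA G A v = countFin (λ e → lookup A e ∧ (eqb (src G e) v ∨ eqb (tgt G e) v))

adjA : (G : Graph) → EdgeSet G → Fin (n G) → Fin (n G) → ℕ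
adjA G A v u = countFin (λ e → lookup A e ∧
  ((eqb (src G e) v ∧ eqb (tgt G e) u) ∨ (eqb (src G e) u ∧ eqb (tgt G e) v)))

VertA : (G : Graph) → EdgeSet G → Set
VertA G A = Σ (Fin (n G)) λ v → ∃ λ e → e ∈ A × (src G e ≡ v ⊎ tgt G e ≡ v)

EdgeA : (G : Graph) → EdgeSet G → Set
EdgeA G A = Σ (Fin (m G)) λ e → e ∈ A

-- normalized Laplacian L(G|A): (Lf)(v) = f(v) - (1/deg v) Σ_{u~v} f(u);
-- matrix entry (row v, column u)
normLap : (G : Graph) (A : EdgeSet G) → VertA G A → VertA G A → ℚ
normLap G A (v , _) (u , _) =
  (if eqb v u then 1ℚ else 0ℚ) - inv (degA G A v) * ℕtoℚ (adjA G A v u)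

sgn : (G : Graph) → Fin (n G) → Fin (m G) → ℚ
sgn G x e' = if eqb (src G e') x then 1ℚ else (if eqb (tgt G e') x then - 1ℚ else 0ℚ)

edgeLap : (G : Graph) (A : EdgeSet G) → EdgeA G A → EdgeA G A → ℚ
edgeLap G A (e , _) (e' , _) =
  inv (degA G A (src G e)) * sgn G (src G e) e'
  - inv (degA G A (tgt G e)) * sgn G (tgt G e) e'

-- The three conditions (fractions cleared by positive denominators)

-- (1) ρ(A) ≤ ρ(E), i.e. |A|/rank(A) ≤ |E|/rank(E)
UniformlyDense : Graph → Set
UniformlyDense G =
  ∀ (A : EdgeSet G) → Nonempty A → ∀ cA cE →
  HasComponents G A cA → HasComponents G ⊤ cE →
  ∣ A ∣ ℕ.* mrank G cE ≤ m G ℕ.* mrank G cA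

-- (2) rank L(G) - rank L(G|A) ≤ (|E| - |A|) / ρ(G),  ρ(G) = |E| / rank(E)
Cond2 : Graph → Set
Cond2 G =
  ∀ (A : EdgeSet G) → Nonempty A → ∀ rG rA cE →
  HasRank (normLap G ⊤) rG → HasRank (normLap G A) rA → HasComponents G ⊤ cE →
  (+ rG ℤ.- + rA) ℤ.* + m G ℤ.≤ (+ m G ℤ.- + ∣ A ∣) ℤ.* + mrank G cE

-- n₀(L¹(H)) = nullity = (#edges of H) - rank L¹(H)
-- (3) n₀(L¹(G|A)) / |A| ≤ n₀(L¹(G)) / |E|
Cond3 : Graph → Set
Cond3 G =
  ∀ (A : EdgeSet G) → Nonempty A → ∀ rE rA →
  HasRank (edgeLap G ⊤) rE → HasRank (edgeLap G A) rA →
  (∣ A ∣ ∸ rA) ℕ.* m G ≤ (m G ∸ rE) ℕ.* ∣ A ∣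

-- Each of the three conditions is equivalent to |A| · r(E) ≤ |E| · r(A), where r(A) is the number
-- of edges of a spanning forest of (V, A), i.e. |V| − c(A). Such a forest is grown Kruskal-style,
-- recording for every vertex x how δ_x − δ_root(x) is a combination of the incidence vectors of the
-- forest edges. With B the incidence matrix, D the degree matrix and W the indicator of A, one has
-- L¹(G|A) = Bᵀ D⁻¹ B and L(G|A) = D⁻¹ B W Bᵀ, so every column of either Laplacian lies in the span
-- of r(A) fixed vectors. Conversely the columns at the forest edges, resp. at the r(A) vertices that
-- stopped being roots during the growth, are independent: a linear relation among them makes a
-- nonnegative quadratic form γᵀ D⁻¹ γ, resp. φᵀ W φ, vanish. Hence both Laplacians have rank r(A),
-- and conditions (2) and (3) turn into the density inequality by integer arithmetic.
{-# OPTIONS --safe #-}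
module Submission where

open import Defs
open import Data.Nat using (_≥_)
open import Data.Product using (_×_)
open import Function.Bundles using (_⇔_)

open import Algebra.Bundles using (CommutativeRing)
open import Data.Bool using (Bool; true; false; if_then_else_; _∧_; _∨_)
import Data.Bool.Properties as Boolₚ
open import Data.Empty using (⊥; ⊥-elim)
open import Data.Fin as Fin using (Fin; zero; suc; punchIn; punchOut)
import Data.Fin.Properties as Finₚ
open import Data.Fin.Subset using (_∈_; ⊤; ∣_∣; Nonempty)
open import Data.Fin.Subset.Properties using (_∈?_)
import Data.Integer as ℤ
import Data.Integer.Properties as ℤₚ
open import Data.Nat as ℕ using (ℕ; zero; suc; _∸_)
import Data.Nat.Coprimality as Coprime
import Data.Nat.Properties as ℕₚ
open import Data.Product using (∃; _,_; proj₁; proj₂)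
open import Data.Rational as ℚ using (ℚ; 0ℚ; 1ℚ; _+_; _*_; _-_; -_; _≤_; 1/_; _/_)
import Data.Rational.Properties as ℚₚ
open import Data.Sum using (_⊎_; inj₁; inj₂)
open import Data.Vec using (lookup)
import Data.Vec.Properties as Vecₚ
open import Data.Vec.Functional using (_∷_)
open import Function using (_∘_; mk⇔; Equivalence)
open import Level using (0ℓ)
open import Relation.Binary.PropositionalEquality
open import Relation.Nullary using (¬_; Dec; yes; no; ¬?)
open import Relation.Nullary.Decidable using (dec⇒maybe; decidable-stable; dec-true; dec-false; _×-dec_)
open import Data.Integer.Tactic.RingSolver using () renaming (solve-∀ to ℤ-solve)
open import Function.Properties.Equivalence using () renaming (trans to ⇔-trans; sym to ⇔-sym)
open import Tactic.RingSolver using (solve-∀)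
open import Tactic.RingSolver.Core.AlmostCommutativeRing using (AlmostCommutativeRing; fromCommutativeRing)

open import Algebra.Properties.Semiring.Sum (CommutativeRing.semiring ℚₚ.+-*-commutativeRing)
  using (sum; sum-syntax; sum-cong-≗; sum-replicate-zero; ∑-distrib-+; ∑-comm; *-distribˡ-sum; *-distribʳ-sum)

ℚ-ring : AlmostCommutativeRing 0ℓ 0ℓ
ℚ-ring = fromCommutativeRing ℚₚ.+-*-commutativeRing (λ x → dec⇒maybe (0ℚ ℚₚ.≟ x))

sumFin≡sum : ∀ {r} (f : Fin r → ℚ) → sumFin f ≡ sum f
sumFin≡sum {zero}  f = refl
sumFin≡sum {suc r} f = cong (f zero +_) (sumFin≡sum (f ∘ suc))

∑-distrib-- : ∀ {r} (f g : Fin r → ℚ) → ∑[ k < r ] (f k - g k) ≡ sum f - sum g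
∑-distrib-- {zero}  f g = refl
∑-distrib-- {suc r} f g =
  trans (cong (f zero - g zero +_) (∑-distrib-- (f ∘ suc) (g ∘ suc)))
        (regroup (f zero) (g zero) (sum (f ∘ suc)) (sum (g ∘ suc)))
  where
  regroup : ∀ a b c d → a - b + (c - d) ≡ a + c - (b + d)
  regroup = solve-∀ ℚ-ring

ind : Bool → ℚ
ind b = if b then 1ℚ else 0ℚ

δ : ∀ {n} → Fin n → Fin n → ℚ
δ x y = ind (eqb x y)

∑-δ : ∀ {n} (p : Fin n) (g : Fin n → ℚ) → ∑[ y < n ] (δ p y * g y) ≡ g p
∑-δ {suc n} zero g = begin
  1ℚ * g zero + ∑[ y < n ] (0ℚ * g (suc y))  ≡⟨ cong (1ℚ * g zero +_) (trans (sum-cong-≗ (λ y → ℚₚ.*-zeroˡ (g (suc y)))) (sum-replicate-zero n)) ⟩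
  1ℚ * g zero + 0ℚ                          ≡⟨ trans (ℚₚ.+-identityʳ _) (ℚₚ.*-identityˡ _) ⟩
  g zero                                    ∎
  where open ≡-Reasoning
∑-δ {suc n} (suc p) g = trans (cong (0ℚ * g zero +_) (∑-δ p (g ∘ suc))) (trans (cong (_+ g (suc p)) (ℚₚ.*-zeroˡ (g zero))) (ℚₚ.+-identityˡ _))

p*q≡0⇒q≡0 : ∀ {p q} → p ≢ 0ℚ → p * q ≡ 0ℚ → q ≡ 0ℚ
p*q≡0⇒q≡0 {p} {q} p≢0 pq≡0 = begin
  q                 ≡⟨ sym (ℚₚ.*-identityˡ q) ⟩
  1ℚ * q            ≡⟨ cong (_* q) (sym (ℚₚ.*-inverseˡ p)) ⟩
  (1/ p * p) * q    ≡⟨ ℚₚ.*-assoc (1/ p) p q ⟩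
  1/ p * (p * q)    ≡⟨ cong (1/ p *_) pq≡0 ⟩
  1/ p * 0ℚ         ≡⟨ ℚₚ.*-zeroʳ (1/ p) ⟩
  0ℚ                ∎
  where
  open ≡-Reasoning
  instance
    p-nonZero : ℚ.NonZero p
    p-nonZero = ℚ.≢-nonZero p≢0

p*p≡0⇒p≡0 : ∀ {p} → p * p ≡ 0ℚ → p ≡ 0ℚ
p*p≡0⇒p≡0 {p} pp≡0 with p ℚₚ.≟ 0ℚ
... | yes p≡0 = p≡0
... | no  p≢0 = p*q≡0⇒q≡0 p≢0 pp≡0

-- ℚₚ.nonPos*nonPos⇒nonPos concludes NonNegative, despite its name.
0≤p*p : ∀ p → 0ℚ ≤ p * p
0≤p*p p with ℚₚ.≤-total 0ℚ p
... | inj₁ 0≤p = ℚₚ.nonNegative⁻¹ _ {{ℚₚ.nonNeg*nonNeg⇒nonNeg p {{ℚ.nonNegative 0≤p}} p {{ℚ.nonNegative 0≤p}}}}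
... | inj₂ p≤0 = ℚₚ.nonNegative⁻¹ _ {{ℚₚ.nonPos*nonPos⇒nonPos p {{ℚ.nonPositive p≤0}} p {{ℚ.nonPositive p≤0}}}}

0≤p*q : ∀ {p q} → 0ℚ ≤ p → 0ℚ ≤ q → 0ℚ ≤ p * q
0≤p*q {p} {q} 0≤p 0≤q = ℚₚ.nonNegative⁻¹ _ {{ℚₚ.nonNeg*nonNeg⇒nonNeg p {{ℚ.nonNegative 0≤p}} q {{ℚ.nonNegative 0≤q}}}}

∑-nonNeg : ∀ {n} (f : Fin n → ℚ) → (∀ k → 0ℚ ≤ f k) → 0ℚ ≤ sum f
∑-nonNeg {zero}  f 0≤f = ℚₚ.≤-refl
∑-nonNeg {suc n} f 0≤f = ℚₚ.+-mono-≤ (0≤f zero) (∑-nonNeg (f ∘ suc) (0≤f ∘ suc))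

∑-nonNeg≡0 : ∀ {n} (f : Fin n → ℚ) → (∀ k → 0ℚ ≤ f k) → sum f ≡ 0ℚ → ∀ k → f k ≡ 0ℚ
∑-nonNeg≡0 {suc n} f 0≤f ∑f≡0 = λ { zero → head≡0 ; (suc k) → ∑-nonNeg≡0 (f ∘ suc) (0≤f ∘ suc) tail≡0 k }
  where
  0≤tail : 0ℚ ≤ sum (f ∘ suc)
  0≤tail = ∑-nonNeg (f ∘ suc) (0≤f ∘ suc)
  head≡0 : f zero ≡ 0ℚ
  head≡0 = ℚₚ.≤-antisym (subst (f zero ≤_) ∑f≡0 (subst (_≤ sum f) (ℚₚ.+-identityʳ _) (ℚₚ.+-monoʳ-≤ (f zero) 0≤tail))) (0≤f zero)
  tail≡0 : sum (f ∘ suc) ≡ 0ℚ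
  tail≡0 = trans (sym (ℚₚ.+-identityˡ _)) (trans (cong (_+ sum (f ∘ suc)) (sym head≡0)) ∑f≡0)

p-q≡0⇒p≡q : ∀ {p q} → p - q ≡ 0ℚ → p ≡ q
p-q≡0⇒p≡q {p} {q} p-q≡0 = trans (shift p q) (trans (cong (_+ q) p-q≡0) (ℚₚ.+-identityˡ q))
  where
  shift : ∀ p q → p ≡ (p - q) + q
  shift = solve-∀ ℚ-ring

-- Linear algebra over ℚ

infix 8 _·_

_·_ : ∀ {r} → (Fin r → ℚ) → (Fin r → ℚ) → ℚ
_·_ {r} u v = ∑[ k < r ] (u k * v k)

·-comm : ∀ {r} (u v : Fin r → ℚ) → u · v ≡ v · u
·-comm u v = sum-cong-≗ (λ k → ℚₚ.*-comm (u k) (v k))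

·-assoc : ∀ {r s} (a : Fin r → ℚ) (b : Fin r → Fin s → ℚ) (w : Fin s → ℚ) →
          a · (λ k → b k · w) ≡ (λ l → a · (λ k → b k l)) · w
·-assoc {r} {s} a b w = begin
  ∑[ k < r ] (a k * ∑[ l < s ] (b k l * w l))    ≡⟨ sum-cong-≗ (λ k → *-distribˡ-sum (a k) (λ l → b k l * w l)) ⟩
  ∑[ k < r ] ∑[ l < s ] (a k * (b k l * w l))    ≡⟨ ∑-comm (λ k l → a k * (b k l * w l)) ⟩
  ∑[ l < s ] ∑[ k < r ] (a k * (b k l * w l))    ≡⟨ sum-cong-≗ (λ l → sum-cong-≗ (λ k → sym (ℚₚ.*-assoc (a k) (b k l) (w l)))) ⟩
  ∑[ l < s ] ∑[ k < r ] (a k * b k l * w l)      ≡⟨ sum-cong-≗ (λ l → sym (*-distribʳ-sum (w l) (λ k → a k * b k l))) ⟩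
  ∑[ l < s ] (∑[ k < r ] (a k * b k l) * w l)    ∎
  where open ≡-Reasoning

·-zeroˡ : ∀ {r} (v : Fin r → ℚ) → (λ _ → 0ℚ) · v ≡ 0ℚ
·-zeroˡ {r} v = trans (sum-cong-≗ (λ k → ℚₚ.*-zeroˡ (v k))) (sum-replicate-zero r)

·-zeroʳ : ∀ {r} (u : Fin r → ℚ) → u · (λ _ → 0ℚ) ≡ 0ℚ
·-zeroʳ u = trans (·-comm u (λ _ → 0ℚ)) (·-zeroˡ u)

·-distrib-- : ∀ {r} (u v w : Fin r → ℚ) → u · (λ k → v k - w k) ≡ u · v - u · w
·-distrib-- u v w = trans (sum-cong-≗ (λ k → *-distribˡ-- (u k) (v k) (w k))) (∑-distrib-- (λ k → u k * v k) (λ k → u k * w k))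
  where
  *-distribˡ-- : ∀ x y z → x * (y - z) ≡ x * y - x * z
  *-distribˡ-- = solve-∀ ℚ-ring

·-*ʳ : ∀ {r} (u v : Fin r → ℚ) c → u · (λ k → v k * c) ≡ (u · v) * c
·-*ʳ u v c = trans (sum-cong-≗ (λ k → sym (ℚₚ.*-assoc (u k) (v k) c))) (sym (*-distribʳ-sum c (λ k → u k * v k)))

·-*ˡ : ∀ {r} (u v : Fin r → ℚ) c → u · (λ k → c * v k) ≡ c * (u · v)
·-*ˡ u v c = trans (sum-cong-≗ (λ k → swap (u k) c (v k))) (sym (*-distribˡ-sum c (λ k → u k * v k)))
  where
  swap : ∀ x c y → x * (c * y) ≡ c * (x * y)
  swap = solve-∀ ℚ-ring

·-sub-scale : ∀ {r} (u v w : Fin r → ℚ) c → u · (λ k → v k - w k * c) ≡ u · v - (u · w) * c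
·-sub-scale u v w c = trans (·-distrib-- u v (λ k → w k * c)) (cong (λ x → u · v - x) (·-*ʳ u w c))

lincomb : ∀ {I : Set} {r} → (Fin r → ℚ) → (Fin r → I → ℚ) → I → ℚ
lincomb a c i = a · (λ k → c k i)

·-lincomb : ∀ {n r} (φ : Fin n → ℚ) (a : Fin r → ℚ) (c : Fin r → Fin n → ℚ) →
            φ · lincomb a c ≡ a · (λ k → φ · c k)
·-lincomb φ a c = begin
  φ · (λ x → a · (λ k → c k x))      ≡⟨ sum-cong-≗ (λ x → cong (φ x *_) (·-comm a (λ k → c k x))) ⟩
  φ · (λ x → (λ k → c k x) · a)      ≡⟨ ·-assoc φ (λ x k → c k x) a ⟩
  (λ k → φ · c k) · a                ≡⟨ ·-comm (λ k → φ · c k) a ⟩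
  a · (λ k → φ · c k)                ∎
  where open ≡-Reasoning

-- φ · (w φ) = Σⱼ aⱼ (cⱼ · w φ) vanishes and is a sum of the nonnegative terms w φ².
orthogonal⇒weighted-zero : ∀ {n r} (w : Fin n → ℚ) (a : Fin r → ℚ) (c : Fin r → Fin n → ℚ) →
  (∀ x → 0ℚ ≤ w x) → (∀ j → c j · (λ x → w x * lincomb a c x) ≡ 0ℚ) → ∀ x → w x * lincomb a c x ≡ 0ℚ
orthogonal⇒weighted-zero {n} w a c 0≤w c⊥wφ x = p*p≡0⇒p≡0 (begin
  ψ x * ψ x          ≡⟨ regroup (w x) (φ x) ⟩
  w x * (φ x * ψ x)  ≡⟨ cong (w x *_) (∑-nonNeg≡0 (λ y → φ y * ψ y) 0≤φψ φ·ψ≡0 x) ⟩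
  w x * 0ℚ           ≡⟨ ℚₚ.*-zeroʳ (w x) ⟩
  0ℚ                 ∎)
  where
  open ≡-Reasoning
  φ ψ : Fin n → ℚ
  φ = lincomb a c
  ψ y = w y * φ y
  regroup : ∀ w φ → (w * φ) * (w * φ) ≡ w * (φ * (w * φ))
  regroup = solve-∀ ℚ-ring
  0≤φψ : ∀ y → 0ℚ ≤ φ y * ψ y
  0≤φψ y = subst (0ℚ ≤_) (commute (w y) (φ y)) (0≤p*q (0≤w y) (0≤p*p (φ y)))
    where commute : ∀ w φ → w * (φ * φ) ≡ φ * (w * φ)
          commute = solve-∀ ℚ-ring
  φ·ψ≡0 : φ · ψ ≡ 0ℚ
  φ·ψ≡0 = begin
    φ · ψ                      ≡⟨ ·-comm φ ψ ⟩
    ψ · φ                      ≡⟨ ·-lincomb ψ a c ⟩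
    a · (λ j → ψ · c j)        ≡⟨ sum-cong-≗ (λ j → cong (a j *_) (trans (·-comm ψ (c j)) (c⊥wφ j))) ⟩
    a · (λ _ → 0ℚ)             ≡⟨ ·-zeroʳ a ⟩
    0ℚ                         ∎

record _∈Span_ {I : Set} {r} (v : I → ℚ) (c : Fin r → I → ℚ) : Set where
  constructor combination
  field
    coeffs    : Fin r → ℚ
    expansion : ∀ i → v i ≡ lincomb coeffs c i

Independent : ∀ {I : Set} {r} → (Fin r → I → ℚ) → Set
Independent {I} {r} c = ∀ (a : Fin r → ℚ) → (∀ i → lincomb a c i ≡ 0ℚ) → ∀ k → a k ≡ 0ℚ

record Dependent {I : Set} {r} (c : Fin r → I → ℚ) : Set where
  constructor dependent
  field
    coeff      : Fin r → ℚ
    witness    : Fin r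
    relation   : ∀ i → lincomb coeff c i ≡ 0ℚ
    nontrivial : coeff witness ≢ 0ℚ

Dependent⇒¬Independent : ∀ {I : Set} {r} {c : Fin r → I → ℚ} → Dependent c → ¬ Independent c
Dependent⇒¬Independent (dependent a k a·c≡0 aₖ≢0) ind = aₖ≢0 (ind a a·c≡0 k)

Independent⇔LinIndep : ∀ {I : Set} {r} (c : Fin r → I → ℚ) → Independent c ⇔ LinIndep c
Independent⇔LinIndep c = mk⇔
  (λ ind a a·c≡0 → ind a (λ i → trans (sym (sumFin≡sum (λ k → a k * c k i))) (a·c≡0 i)))
  (λ ind a a·c≡0 → ind a (λ i → trans (sumFin≡sum (λ k → a k * c k i)) (a·c≡0 i)))

Independent-tail : ∀ {I : Set} {r} {c : Fin (suc r) → I → ℚ} → Independent c → Independent (c ∘ suc)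
Independent-tail {c = c} ind a a·c≡0 k = ind (0ℚ ∷ a) padded (suc k)
  where
  padded : ∀ i → 0ℚ * c zero i + lincomb a (c ∘ suc) i ≡ 0ℚ
  padded i = trans (cong (_+ lincomb a (c ∘ suc) i) (ℚₚ.*-zeroˡ (c zero i))) (trans (ℚₚ.+-identityˡ _) (a·c≡0 i))

Independent-extend : ∀ {n r} {c : Fin (suc r) → Fin n → ℚ} (φ : Fin n → ℚ) →
                     (∀ l → φ · c (suc l) ≡ 0ℚ) → φ · c zero ≢ 0ℚ → Independent (c ∘ suc) → Independent c
Independent-extend {c = c} φ φ⊥tail φ·c₀≢0 ind a a·c≡0 = λ { zero → a₀≡0 ; (suc k) → ind (a ∘ suc) tail≡0 k }
  where
  open ≡-Reasoning
  a₀≡0 : a zero ≡ 0ℚ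
  a₀≡0 = p*q≡0⇒q≡0 φ·c₀≢0 (begin
    φ · c zero * a zero                                       ≡⟨ ℚₚ.*-comm (φ · c zero) (a zero) ⟩
    a zero * φ · c zero                                       ≡⟨ sym (ℚₚ.+-identityʳ _) ⟩
    a zero * φ · c zero + 0ℚ                                  ≡⟨ cong (a zero * φ · c zero +_) (sym tail-vanishes) ⟩
    a · (λ k → φ · c k)                                       ≡⟨ sym (·-lincomb φ a c) ⟩
    φ · lincomb a c                                           ≡⟨ sum-cong-≗ (λ x → cong (φ x *_) (a·c≡0 x)) ⟩
    φ · (λ _ → 0ℚ)                                            ≡⟨ ·-zeroʳ φ ⟩
    0ℚ                                                        ∎)
    where
    tail-vanishes : (a ∘ suc) · (λ l → φ · c (suc l)) ≡ 0ℚ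
    tail-vanishes = trans (sum-cong-≗ (λ l → cong (a (suc l) *_) (φ⊥tail l))) (·-zeroʳ (a ∘ suc))
  tail≡0 : ∀ i → lincomb (a ∘ suc) (c ∘ suc) i ≡ 0ℚ
  tail≡0 i = begin
    lincomb (a ∘ suc) (c ∘ suc) i                             ≡⟨ sym (ℚₚ.+-identityˡ _) ⟩
    0ℚ + lincomb (a ∘ suc) (c ∘ suc) i                        ≡⟨ cong (_+ lincomb (a ∘ suc) (c ∘ suc) i) head-vanishes ⟩
    a zero * c zero i + lincomb (a ∘ suc) (c ∘ suc) i         ≡⟨ a·c≡0 i ⟩
    0ℚ                                                        ∎
    where
    head-vanishes : 0ℚ ≡ a zero * c zero i
    head-vanishes = sym (trans (cong (_* c zero i) a₀≡0) (ℚₚ.*-zeroˡ (c zero i)))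

∈Span-cong : ∀ {I : Set} {r} {v v' : I → ℚ} {c : Fin r → I → ℚ} → (∀ i → v i ≡ v' i) → v ∈Span c → v' ∈Span c
∈Span-cong v≗v' (combination a v≗a·c) = combination a λ i → trans (sym (v≗v' i)) (v≗a·c i)

∈Span-head : ∀ {I : Set} {r} (c : Fin (suc r) → I → ℚ) → c zero ∈Span c
∈Span-head c = combination (1ℚ ∷ λ _ → 0ℚ) λ i → sym (begin
  1ℚ * c zero i + (λ _ → 0ℚ) · (λ k → c (suc k) i)  ≡⟨ cong₂ _+_ (ℚₚ.*-identityˡ (c zero i)) (·-zeroˡ (λ k → c (suc k) i)) ⟩
  c zero i + 0ℚ                                    ≡⟨ ℚₚ.+-identityʳ (c zero i) ⟩
  c zero i                                         ∎)
  where open ≡-Reasoning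

∈Span-tail : ∀ {I : Set} {r} {v : I → ℚ} {c : Fin (suc r) → I → ℚ} → v ∈Span (c ∘ suc) → v ∈Span c
∈Span-tail {c = c} (combination a v≗a·c) = combination (0ℚ ∷ a) λ i →
  trans (v≗a·c i) (sym (trans (cong (_+ lincomb a (c ∘ suc) i) (ℚₚ.*-zeroˡ (c zero i))) (ℚₚ.+-identityˡ _)))

∈Span-+ : ∀ {I : Set} {r} {u v : I → ℚ} {c : Fin r → I → ℚ} → u ∈Span c → v ∈Span c → (λ i → u i + v i) ∈Span c
∈Span-+ {r = r} {u} {v} {c} (combination a u≗a·c) (combination b v≗b·c) = combination (λ k → a k + b k) λ i → begin
  u i + v i                                 ≡⟨ cong₂ _+_ (u≗a·c i) (v≗b·c i) ⟩
  lincomb a c i + lincomb b c i             ≡⟨ sym (∑-distrib-+ (λ k → a k * c k i) (λ k → b k * c k i)) ⟩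
  ∑[ k < r ] (a k * c k i + b k * c k i)    ≡⟨ sum-cong-≗ (λ k → sym (ℚₚ.*-distribʳ-+ (c k i) (a k) (b k))) ⟩
  lincomb (λ k → a k + b k) c i             ∎
  where open ≡-Reasoning

∈Span-- : ∀ {I : Set} {r} {u v : I → ℚ} {c : Fin r → I → ℚ} → u ∈Span c → v ∈Span c → (λ i → u i - v i) ∈Span c
∈Span-- {r = r} {u} {v} {c} (combination a u≗a·c) (combination b v≗b·c) = combination (λ k → a k - b k) λ i → begin
  u i - v i                                 ≡⟨ cong₂ _-_ (u≗a·c i) (v≗b·c i) ⟩
  lincomb a c i - lincomb b c i             ≡⟨ sym (∑-distrib-- (λ k → a k * c k i) (λ k → b k * c k i)) ⟩
  ∑[ k < r ] (a k * c k i - b k * c k i)    ≡⟨ sum-cong-≗ (λ k → sym (*-distribʳ-- (a k) (b k) (c k i))) ⟩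
  lincomb (λ k → a k - b k) c i             ∎
  where
  open ≡-Reasoning
  *-distribʳ-- : ∀ x y z → (x - y) * z ≡ x * z - y * z
  *-distribʳ-- = solve-∀ ℚ-ring

∈Span-scale : ∀ {I : Set} {r} (f : I → ℚ) {v : I → ℚ} {c : Fin r → I → ℚ} →
              v ∈Span c → (λ i → f i * v i) ∈Span (λ l i → f i * c l i)
∈Span-scale f {c = c} (combination a v≗a·c) = combination a λ i →
  trans (cong (f i *_) (v≗a·c i)) (sym (·-*ˡ a (λ l → c l i) (f i)))

∈Span-map : ∀ {I : Set} {n r} (K : I → Fin n → ℚ) {v : Fin n → ℚ} {c : Fin r → Fin n → ℚ} →
            v ∈Span c → (λ i → K i · v) ∈Span (λ l i → K i · c l)
∈Span-map K {c = c} (combination a v≗a·c) = combination a λ i → trans (sum-cong-≗ (λ x → cong (K i x *_) (v≗a·c x))) (·-lincomb (K i) a c)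

-- Gaussian elimination: clear a coordinate p on which the first vector is nonzero.
suc-family-dependent : ∀ r (β : Fin (suc r) → Fin r → ℚ) → Dependent β
suc-family-dependent zero    β = dependent (λ _ → 1ℚ) zero (λ ()) ℚₚ.1≢0
suc-family-dependent (suc r) β with Finₚ.any? (λ l → ¬? (β zero l ℚₚ.≟ 0ℚ))
... | no β₀≡0 = dependent (1ℚ ∷ λ _ → 0ℚ) zero relation ℚₚ.1≢0
  where
  relation : ∀ l → 1ℚ * β zero l + (λ _ → 0ℚ) · (λ k → β (suc k) l) ≡ 0ℚ
  relation l = begin
    1ℚ * β zero l + (λ _ → 0ℚ) · (λ k → β (suc k) l)  ≡⟨ cong₂ _+_ (ℚₚ.*-identityˡ (β zero l)) (·-zeroˡ (λ k → β (suc k) l)) ⟩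
    β zero l + 0ℚ                                     ≡⟨ ℚₚ.+-identityʳ _ ⟩
    β zero l                                          ≡⟨ decidable-stable (β zero l ℚₚ.≟ 0ℚ) (λ β₀ₗ≢0 → β₀≡0 (l , β₀ₗ≢0)) ⟩
    0ℚ                                                ∎
    where open ≡-Reasoning
... | yes (p , β₀ₚ≢0) = dependent (- (S p * q) ∷ a) (suc k) relation aₖ≢0
  where
  instance
    pivot-nonZero : ℚ.NonZero (β zero p)
    pivot-nonZero = ℚ.≢-nonZero β₀ₚ≢0
  q : ℚ
  q = 1/ β zero p
  β' : Fin (suc r) → Fin r → ℚ
  β' k l = β (suc k) (punchIn p l) - β (suc k) p * (q * β zero (punchIn p l))
  open Dependent (suc-family-dependent r β') renaming (coeff to a; witness to k; relation to a·β'≡0; nontrivial to aₖ≢0)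
  S : Fin (suc r) → ℚ
  S = lincomb a (β ∘ suc)
  rearrange : ∀ s q b t → - (s * q) * b + t ≡ t - s * (q * b)
  rearrange = solve-∀ ℚ-ring
  relation : ∀ l → - (S p * q) * β zero l + S l ≡ 0ℚ
  relation l with l Fin.≟ p
  ... | yes refl = begin
    - (S l * q) * β zero l + S l  ≡⟨ rearrange (S l) q (β zero l) (S l) ⟩
    S l - S l * (q * β zero l)    ≡⟨ cong (λ x → S l - S l * x) (ℚₚ.*-inverseˡ (β zero l)) ⟩
    S l - S l * 1ℚ                ≡⟨ cong (λ x → S l - x) (ℚₚ.*-identityʳ (S l)) ⟩
    S l - S l                     ≡⟨ ℚₚ.+-inverseʳ (S l) ⟩
    0ℚ                            ∎
    where open ≡-Reasoning
  ... | no l≢p = begin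
    - (S p * q) * β zero l + S l  ≡⟨ rearrange (S p) q (β zero l) (S l) ⟩
    S l - S p * (q * β zero l)    ≡⟨ cong (λ x → S x - S p * (q * β zero x)) (sym (Finₚ.punchIn-punchOut p≢l)) ⟩
    S l' - S p * (q * β zero l')  ≡⟨ sym (·-sub-scale a (λ k → β (suc k) l') (λ k → β (suc k) p) (q * β zero l')) ⟩
    lincomb a β' (punchOut p≢l)   ≡⟨ a·β'≡0 (punchOut p≢l) ⟩
    0ℚ                            ∎
    where
    open ≡-Reasoning
    p≢l : p ≢ l
    p≢l = l≢p ∘ sym
    l' : Fin (suc r)
    l' = punchIn p (punchOut p≢l)

∈Span⇒Dependent : ∀ {I : Set} {r} (w : Fin r → I → ℚ) (v : Fin (suc r) → I → ℚ) →
                  (∀ k → v k ∈Span w) → Dependent v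
∈Span⇒Dependent {r = r} w v v∈⟨w⟩ = dependent a k a·v≡0 aₖ≢0
  where
  b : Fin (suc r) → Fin r → ℚ
  b k = _∈Span_.coeffs (v∈⟨w⟩ k)
  open Dependent (suc-family-dependent r b) renaming (coeff to a; witness to k; relation to a·b≡0; nontrivial to aₖ≢0)
  a·v≡0 : ∀ i → lincomb a v i ≡ 0ℚ
  a·v≡0 i = begin
    a · (λ k → v k i)                           ≡⟨ sum-cong-≗ (λ k → cong (a k *_) (_∈Span_.expansion (v∈⟨w⟩ k) i)) ⟩
    a · (λ k → b k · (λ l → w l i))             ≡⟨ ·-assoc a b (λ l → w l i) ⟩
    (λ l → lincomb a b l) · (λ l → w l i)       ≡⟨ sum-cong-≗ (λ l → cong (_* w l i) (a·b≡0 l)) ⟩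
    (λ _ → 0ℚ) · (λ l → w l i)                  ≡⟨ ·-zeroˡ (λ l → w l i) ⟩
    0ℚ                                          ∎
    where open ≡-Reasoning

columns : ∀ {I J : Set} {r} → (I → J → ℚ) → (Fin r → J) → Fin r → I → ℚ
columns M s k i = M i (s k)

hasRank : ∀ {I J : Set} {r} (M : I → J → ℚ) (s : Fin r → J) (w : Fin r → I → ℚ) →
          Independent (columns M s) → (∀ j → (λ i → M i j) ∈Span w) → HasRank M r
hasRank M s w ind spanned =
  (s , Equivalence.to (Independent⇔LinIndep (columns M s)) ind) ,
  λ s' → Dependent⇒¬Independent {c = columns M s'} (∈Span⇒Dependent w (columns M s') (spanned ∘ s')) ∘ Equivalence.from (Independent⇔LinIndep (columns M s'))

rank-≤ : ∀ {I J : Set} (M : I → J → ℚ) {r r'} → HasRank M r → HasRank M r' → r ℕ.≤ r'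
rank-≤ M {r} {r'} ((s , ind) , _) (_ , dependent') = ℕₚ.≮⇒≥ (λ r'<r → beyond r'<r s (Equivalence.from (Independent⇔LinIndep (columns M s)) ind))
  where
  beyond : ∀ {n} → r' ℕ.< n → (s : Fin n → _) → ¬ Independent (columns M s)
  beyond {suc n} (ℕ.s≤s r'≤n) s ind with r' ℕ.≟ n
  ... | yes refl = dependent' s (Equivalence.to (Independent⇔LinIndep (columns M s)) ind)
  ... | no r'≢n  = beyond (ℕₚ.≤∧≢⇒< r'≤n r'≢n) (s ∘ suc) (Independent-tail {c = columns M s} ind)

rank-unique : ∀ {I J : Set} (M : I → J → ℚ) {r r'} → HasRank M r → HasRank M r' → r ≡ r'
rank-unique M h h' = ℕₚ.≤-antisym (rank-≤ M h h') (rank-≤ M h' h)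

Reach-trans : ∀ {G A x y z} → Reach G A x y → Reach G A y z → Reach G A x z
Reach-trans here                 y⇝z = y⇝z
Reach-trans (step e e∈A e~ x⇝y) y⇝z = step e e∈A e~ (Reach-trans x⇝y y⇝z)

Reach-invariant : ∀ {G A} {X : Set} (f : Fin (n G) → X) → (∀ e → e ∈ A → f (src G e) ≡ f (tgt G e)) →
                  ∀ {x y} → Reach G A x y → f x ≡ f y
Reach-invariant f f-joins here = refl
Reach-invariant f f-joins (step e e∈A (inj₁ (refl , refl)) rest) = trans (f-joins e e∈A) (Reach-invariant f f-joins rest)
Reach-invariant f f-joins (step e e∈A (inj₂ (refl , refl)) rest) = trans (sym (f-joins e e∈A)) (Reach-invariant f f-joins rest)

HasComponents-≤ : ∀ {G A c c'} → HasComponents G A c → HasComponents G A c' → c ℕ.≤ c'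
HasComponents-≤ {G} {A} {c} {c'} (f , f-onto , f-reach) (g , _ , g-reach) = Finₚ.injective⇒≤ {f = g ∘ pick} injective
  where
  pick : Fin c → Fin (n G)
  pick i = proj₁ (f-onto i)
  injective : ∀ {i j} → g (pick i) ≡ g (pick j) → i ≡ j
  injective {i} {j} same = trans (sym (proj₂ (f-onto i)))
    (trans (Equivalence.from (f-reach (pick i) (pick j)) (Equivalence.to (g-reach (pick i) (pick j)) same)) (proj₂ (f-onto j)))

HasComponents-unique : ∀ {G A c c'} → HasComponents G A c → HasComponents G A c' → c ≡ c'
HasComponents-unique h h' = ℕₚ.≤-antisym (HasComponents-≤ h h') (HasComponents-≤ h' h)

Incident : (G : Graph) → EdgeSet G → Fin (n G) → Set
Incident G A x = ∃ λ e → e ∈ A × (src G e ≡ x ⊎ tgt G e ≡ x)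

Reach⇒≡⊎Incident : ∀ {G A x y} → Reach G A x y → x ≡ y ⊎ Incident G A x
Reach⇒≡⊎Incident here                             = inj₁ refl
Reach⇒≡⊎Incident (step e e∈A (inj₁ (src≡x , _)) _) = inj₂ (e , e∈A , inj₁ src≡x)
Reach⇒≡⊎Incident (step e e∈A (inj₂ (_ , tgt≡x)) _) = inj₂ (e , e∈A , inj₂ tgt≡x)

merge : ∀ {k} {i j : Fin (suc k)} → i ≢ j → Fin (suc k) → Fin k
merge {i = i} {j} i≢j c with c Fin.≟ j
... | yes _   = punchOut (i≢j ∘ sym)
... | no  c≢j = punchOut (c≢j ∘ sym)

module _ {k} {i j : Fin (suc k)} (i≢j : i ≢ j) where

  merge-identifies : merge i≢j i ≡ merge i≢j j
  merge-identifies with i Fin.≟ j | j Fin.≟ j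
  ... | yes i≡j | _       = ⊥-elim (i≢j i≡j)
  ... | no  _   | no  j≢j = ⊥-elim (j≢j refl)
  ... | no  _   | yes _   = Finₚ.punchOut-cong j refl

  merge-fibre : ∀ c c' → merge i≢j c ≡ merge i≢j c' → c ≡ c' ⊎ (c ≡ j × c' ≡ i) ⊎ (c ≡ i × c' ≡ j)
  merge-fibre c c' same with c Fin.≟ j | c' Fin.≟ j
  ... | yes c≡j | yes c'≡j = inj₁ (trans c≡j (sym c'≡j))
  ... | yes c≡j | no  c'≢j = inj₂ (inj₁ (c≡j , sym (Finₚ.punchOut-injective (i≢j ∘ sym) (c'≢j ∘ sym) same)))
  ... | no  c≢j | yes c'≡j = inj₂ (inj₂ (Finₚ.punchOut-injective (c≢j ∘ sym) (i≢j ∘ sym) same , c'≡j))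
  ... | no  c≢j | no  c'≢j = inj₁ (Finₚ.punchOut-injective (c≢j ∘ sym) (c'≢j ∘ sym) same)

  punchIn-merge-≡ : ∀ c → c ≡ j → punchIn j (merge i≢j c) ≡ i
  punchIn-merge-≡ c c≡j with c Fin.≟ j
  ... | yes _   = Finₚ.punchIn-punchOut (i≢j ∘ sym)
  ... | no  c≢j = ⊥-elim (c≢j c≡j)

  punchIn-merge-≢ : ∀ c → c ≢ j → punchIn j (merge i≢j c) ≡ c
  punchIn-merge-≢ c c≢j with c Fin.≟ j
  ... | yes c≡j = ⊥-elim (c≢j c≡j)
  ... | no  _   = Finₚ.punchIn-punchOut (c≢j ∘ sym)

  merge-punchIn : ∀ l → merge i≢j (punchIn j l) ≡ l
  merge-punchIn l with punchIn j l Fin.≟ j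
  ... | yes p≡j = ⊥-elim (Finₚ.punchInᵢ≢i j l p≡j)
  ... | no  _   = trans (Finₚ.punchOut-cong j refl) (Finₚ.punchOut-punchIn j)

-- Incidence vectors and the two Laplacians

δ-refl : ∀ {n} (x : Fin n) → δ x x ≡ 1ℚ
δ-refl x = cong ind (dec-true (x Fin.≟ x) refl)

δ-≢ : ∀ {n} {x y : Fin n} → x ≢ y → δ x y ≡ 0ℚ
δ-≢ {x = x} {y} x≢y = cong ind (dec-false (x Fin.≟ y) x≢y)

eqb∧eqb≡false : ∀ {n} {x y x' y' : Fin n} → (x ≡ y → x' ≡ y' → ⊥) → eqb x y ∧ eqb x' y' ≡ false
eqb∧eqb≡false {x = x} {y} {x'} {y'} exclusive with x Fin.≟ y | x' Fin.≟ y'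
... | yes x≡y | yes x'≡y' = ⊥-elim (exclusive x≡y x'≡y')
... | yes _   | no  _     = refl
... | no  _   | _         = refl

incidence : (G : Graph) → Fin (m G) → Fin (n G) → ℚ
incidence G e y = sgn G y e

sgnb : Bool → Bool → ℚ
sgnb a b = if a then 1ℚ else (if b then - 1ℚ else 0ℚ)

module _ (G : Graph) where

  src-tgt-exclusive : ∀ e y → eqb (src G e) y ∧ eqb (tgt G e) y ≡ false
  src-tgt-exclusive e y = eqb∧eqb≡false {x = src G e} {y} {tgt G e} {y} (λ s≡y t≡y → loopless G e (trans s≡y (sym t≡y)))

  incidence≡δ-δ : ∀ e y → incidence G e y ≡ δ (src G e) y - δ (tgt G e) y
  incidence≡δ-δ e y = signed (eqb (src G e) y) (eqb (tgt G e) y) (src-tgt-exclusive e y)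
    where
    signed : ∀ a b → a ∧ b ≡ false → sgnb a b ≡ ind a - ind b
    signed true  false _ = refl
    signed false true  _ = refl
    signed false false _ = refl

  incidence-· : ∀ e (h : Fin (n G) → ℚ) → incidence G e · h ≡ h (src G e) - h (tgt G e)
  incidence-· e h = begin
    incidence G e · h                                 ≡⟨ sum-cong-≗ (λ y → cong (_* h y) (incidence≡δ-δ e y)) ⟩
    (λ y → δ (src G e) y - δ (tgt G e) y) · h         ≡⟨ ·-comm _ h ⟩
    h · (λ y → δ (src G e) y - δ (tgt G e) y)         ≡⟨ ·-distrib-- h (δ (src G e)) (δ (tgt G e)) ⟩
    h · δ (src G e) - h · δ (tgt G e)                 ≡⟨ cong₂ _-_ (δ-· (src G e)) (δ-· (tgt G e)) ⟩
    h (src G e) - h (tgt G e)                         ∎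
    where
    open ≡-Reasoning
    δ-· : ∀ x → h · δ x ≡ h x
    δ-· x = trans (·-comm h (δ x)) (∑-δ x h)

ℕtoℚ≡mkℚ : ∀ k → ℕtoℚ k ≡ ℚ.mkℚ (ℤ.+ k) 0 (Coprime.sym (Coprime.1-coprimeTo k))
ℕtoℚ≡mkℚ k = ℚₚ.↥p/↧p≡p (ℚ.mkℚ (ℤ.+ k) 0 (Coprime.sym (Coprime.1-coprimeTo k)))

ℕtoℚ-suc : ∀ k → ℕtoℚ (suc k) ≡ 1ℚ + ℕtoℚ k
ℕtoℚ-suc k rewrite ℕtoℚ≡mkℚ k = cong (λ j → (ℤ.+ 1 ℤ.+ j) / 1) (sym (ℤₚ.*-identityʳ (ℤ.+ k)))

inv*ℕtoℚ : ∀ k → k ≢ 0 → inv k * ℕtoℚ k ≡ 1ℚ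
inv*ℕtoℚ zero    k≢0 = ⊥-elim (k≢0 refl)
inv*ℕtoℚ (suc k) _ rewrite ℕtoℚ≡mkℚ (suc k) =
  trans (cong (_* q) (ℚₚ.↥p/↧p≡p (1/ q))) (ℚₚ.*-inverseˡ q)
  where
  q : ℚ
  q = ℚ.mkℚ (ℤ.+ suc k) 0 (Coprime.sym (Coprime.1-coprimeTo (suc k)))

inv≢0 : ∀ k → k ≢ 0 → inv k ≢ 0ℚ
inv≢0 k k≢0 inv≡0 = ℚₚ.1≢0 (trans (sym (inv*ℕtoℚ k k≢0)) (trans (cong (_* ℕtoℚ k) inv≡0) (ℚₚ.*-zeroˡ (ℕtoℚ k))))

0≤inv : ∀ k → 0ℚ ≤ inv k
0≤inv zero    = ℚₚ.≤-refl
0≤inv (suc k) = ℚₚ.nonNegative⁻¹ (inv (suc k)) {{ℚₚ.normalize-nonNeg 1 (suc k)}}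

0≤ind : ∀ b → 0ℚ ≤ ind b
0≤ind true  = ℚₚ.nonNegative⁻¹ 1ℚ
0≤ind false = ℚₚ.≤-refl

∑-ind≡countFin : ∀ {r} (p : Fin r → Bool) → ∑[ e < r ] ind (p e) ≡ ℕtoℚ (countFin p)
∑-ind≡countFin {zero}  p = refl
∑-ind≡countFin {suc r} p with p zero
... | true  = trans (cong (1ℚ +_) (∑-ind≡countFin (p ∘ suc))) (sym (ℕtoℚ-suc (countFin (p ∘ suc))))
... | false = trans (ℚₚ.+-identityˡ _) (∑-ind≡countFin (p ∘ suc))

countFin≡0⇒false : ∀ {r} (p : Fin r → Bool) → countFin p ≡ 0 → ∀ e → p e ≡ false
countFin≡0⇒false {suc r} p count≡0 e with p zero in p₀
countFin≡0⇒false {suc r} p count≡0 zero    | false = p₀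
countFin≡0⇒false {suc r} p count≡0 (suc e) | false = countFin≡0⇒false (p ∘ suc) count≡0 e

sgnb-square : ∀ L a b → a ∧ b ≡ false →
  ind L * (sgnb a b * sgnb a b) ≡ 1ℚ * ind (L ∧ (a ∨ b)) - ind (L ∧ (a ∧ b ∨ a ∧ b))
sgnb-square L     true  true  ()
sgnb-square true  true  false _ = refl
sgnb-square true  false true  _ = refl
sgnb-square true  false false _ = refl
sgnb-square false true  false _ = refl
sgnb-square false false true  _ = refl
sgnb-square false false false _ = refl

sgnb-product : ∀ L a b c d → a ∧ b ≡ false → c ∧ d ≡ false → a ∧ c ≡ false → b ∧ d ≡ false →
  ind L * (sgnb a b * sgnb c d) ≡ 0ℚ * ind (L ∧ (a ∨ b)) - ind (L ∧ (a ∧ d ∨ c ∧ b))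
sgnb-product L     true  true  c     d     () _  _  _
sgnb-product L     a     b     true  true  _  () _  _
sgnb-product L     true  b     true  d     _  _  () _
sgnb-product L     a     true  c     true  _  _  _  ()
sgnb-product false a     b     c     d     _  _  _  _ = ℚₚ.*-zeroˡ (sgnb a b * sgnb c d)
sgnb-product true  true  false false true  _  _  _  _ = refl
sgnb-product true  true  false false false _  _  _  _ = refl
sgnb-product true  false true  true  false _  _  _  _ = refl
sgnb-product true  false true  false false _  _  _  _ = refl
sgnb-product true  false false true  false _  _  _  _ = refl
sgnb-product true  false false false true  _  _  _  _ = refl
sgnb-product true  false false false false _  _  _  _ = refl

module _ (G : Graph) (A : EdgeSet G) where

  weight : Fin (m G) → ℚ
  weight e = ind (lookup A e)

  invDeg : Fin (n G) → ℚ
  invDeg x = inv (degA G A x)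

  degree≡0⇒incidence≡0 : ∀ x e → degA G A x ≡ 0 → e ∈ A → incidence G e x ≡ 0ℚ
  degree≡0⇒incidence≡0 x e deg≡0 e∈A = unsigned (eqb (src G e) x) (eqb (tgt G e) x)
    (subst (λ L → L ∧ (eqb (src G e) x ∨ eqb (tgt G e) x) ≡ false) (Vecₚ.[]=⇒lookup e∈A)
      (countFin≡0⇒false (λ e → lookup A e ∧ (eqb (src G e) x ∨ eqb (tgt G e) x)) deg≡0 e))
    where
    unsigned : ∀ a b → a ∨ b ≡ false → sgnb a b ≡ 0ℚ
    unsigned false false _ = refl

  Incident⇒degree≢0 : ∀ x → Incident G A x → degA G A x ≢ 0
  Incident⇒degree≢0 x (e , e∈A , endpoint) deg≡0 = true≢false (begin
    true                                                     ≡⟨ cong₂ _∧_ (sym (Vecₚ.[]=⇒lookup e∈A)) (endpoint⇒true endpoint) ⟩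
    lookup A e ∧ (eqb (src G e) x ∨ eqb (tgt G e) x)        ≡⟨ countFin≡0⇒false (λ e → lookup A e ∧ (eqb (src G e) x ∨ eqb (tgt G e) x)) deg≡0 e ⟩
    false                                                    ∎)
    where
    open ≡-Reasoning
    true≢false : true ≢ false
    true≢false ()
    endpoint⇒true : src G e ≡ x ⊎ tgt G e ≡ x → true ≡ eqb (src G e) x ∨ eqb (tgt G e) x
    endpoint⇒true (inj₁ s≡x) = sym (cong (_∨ eqb (tgt G e) x) (dec-true (src G e Fin.≟ x) s≡x))
    endpoint⇒true (inj₂ t≡x) = sym (trans (cong (eqb (src G e) x ∨_) (dec-true (tgt G e Fin.≟ x) t≡x)) (Boolₚ.∨-zeroʳ _))

  incidence-product : ∀ v u e → weight e * (incidence G e v * incidence G e u) ≡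
    δ v u * ind (lookup A e ∧ (eqb (src G e) v ∨ eqb (tgt G e) v)) -
    ind (lookup A e ∧ (eqb (src G e) v ∧ eqb (tgt G e) u ∨ eqb (src G e) u ∧ eqb (tgt G e) v))
  incidence-product v u e with v Fin.≟ u
  ... | yes refl = sgnb-square (lookup A e) (eqb (src G e) v) (eqb (tgt G e) v) (src-tgt-exclusive G e v)
  ... | no  v≢u  = sgnb-product (lookup A e) (eqb (src G e) v) (eqb (tgt G e) v) (eqb (src G e) u) (eqb (tgt G e) u)
                     (src-tgt-exclusive G e v) (src-tgt-exclusive G e u) (distinct (src G e)) (distinct (tgt G e))
    where
    distinct : ∀ x → eqb x v ∧ eqb x u ≡ false
    distinct x = eqb∧eqb≡false {x = x} {v} {x} {u} (λ x≡v x≡u → v≢u (trans (sym x≡v) x≡u))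

  ∑-incidence-product : ∀ v u → ∑[ e < m G ] (weight e * (incidence G e v * incidence G e u)) ≡
                                δ v u * ℕtoℚ (degA G A v) - ℕtoℚ (adjA G A v u)
  ∑-incidence-product v u = begin
    ∑[ e < m G ] (weight e * (incidence G e v * incidence G e u))  ≡⟨ sum-cong-≗ (incidence-product v u) ⟩
    ∑[ e < m G ] (δ v u * ind (degree e) - ind (adjacent e))       ≡⟨ ∑-distrib-- (λ e → δ v u * ind (degree e)) (λ e → ind (adjacent e)) ⟩
    ∑[ e < m G ] (δ v u * ind (degree e)) - ∑[ e < m G ] ind (adjacent e)
      ≡⟨ cong₂ _-_ (trans (sym (*-distribˡ-sum (δ v u) (ind ∘ degree))) (cong (δ v u *_) (∑-ind≡countFin degree))) (∑-ind≡countFin adjacent) ⟩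
    δ v u * ℕtoℚ (degA G A v) - ℕtoℚ (adjA G A v u)              ∎
    where
    open ≡-Reasoning
    degree adjacent : Fin (m G) → Bool
    degree   e = lookup A e ∧ (eqb (src G e) v ∨ eqb (tgt G e) v)
    adjacent e = lookup A e ∧ (eqb (src G e) v ∧ eqb (tgt G e) u ∨ eqb (src G e) u ∧ eqb (tgt G e) v)

  normLap≡ : ∀ v (v∈ : Incident G A v) u (u∈ : Incident G A u) →
             normLap G A (v , v∈) (u , u∈) ≡ (λ e → invDeg v * incidence G e v) · (λ e → weight e * incidence G e u)
  normLap≡ v v∈ u u∈ = sym (begin
    (λ e → invDeg v * incidence G e v) · (λ e → weight e * incidence G e u)
      ≡⟨ sum-cong-≗ (λ e → regroup (invDeg v) (incidence G e v) (weight e) (incidence G e u)) ⟩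
    ∑[ e < m G ] (invDeg v * (weight e * (incidence G e v * incidence G e u)))
      ≡⟨ sym (*-distribˡ-sum (invDeg v) (λ e → weight e * (incidence G e v * incidence G e u))) ⟩
    invDeg v * ∑[ e < m G ] (weight e * (incidence G e v * incidence G e u))
      ≡⟨ cong (invDeg v *_) (∑-incidence-product v u) ⟩
    invDeg v * (δ v u * ℕtoℚ (degA G A v) - ℕtoℚ (adjA G A v u))
      ≡⟨ distrib (invDeg v) (δ v u) (ℕtoℚ (degA G A v)) (ℕtoℚ (adjA G A v u)) ⟩
    δ v u * (invDeg v * ℕtoℚ (degA G A v)) - invDeg v * ℕtoℚ (adjA G A v u)
      ≡⟨ cong (λ x → δ v u * x - invDeg v * ℕtoℚ (adjA G A v u)) (inv*ℕtoℚ (degA G A v) (Incident⇒degree≢0 v v∈)) ⟩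
    δ v u * 1ℚ - invDeg v * ℕtoℚ (adjA G A v u)
      ≡⟨ cong (_- invDeg v * ℕtoℚ (adjA G A v u)) (ℚₚ.*-identityʳ (δ v u)) ⟩
    normLap G A (v , v∈) (u , u∈) ∎)
    where
    open ≡-Reasoning
    regroup : ∀ d b w c → d * b * (w * c) ≡ d * (w * (b * c))
    regroup = solve-∀ ℚ-ring
    distrib : ∀ d x g a → d * (x * g - a) ≡ x * (d * g) - d * a
    distrib = solve-∀ ℚ-ring

  edgeLap≡ : ∀ e (e∈ : e ∈ A) e' (e'∈ : e' ∈ A) →
             edgeLap G A (e , e∈) (e' , e'∈) ≡ incidence G e · (λ x → invDeg x * incidence G e' x)
  edgeLap≡ e _ e' _ = sym (incidence-· G e (λ x → invDeg x * incidence G e' x))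

-- Spanning forests

δ-diff : ∀ {n} → Fin n → Fin n → Fin n → ℚ
δ-diff x y z = δ x z - δ y z

module _ (G : Graph) (A : EdgeSet G) where

  -- Edge l of the forest merged the component of root (retired l) into another one.
  record Forest (k r : ℕ) : Set where
    field
      count             : k ℕ.+ r ≡ n G
      label             : Fin (n G) → Fin k
      root              : Fin k → Fin (n G)
      label-root        : ∀ i → label (root i) ≡ i
      label⇒Reach       : ∀ x y → label x ≡ label y → Reach G A x y
      edge              : Fin r → Fin (m G)
      edge∈A            : ∀ l → edge l ∈ A
      edge-joins        : ∀ l → label (src G (edge l)) ≡ label (tgt G (edge l))
      edge-injective    : ∀ l l' → edge l ≡ edge l' → l ≡ l'
      edges-independent : Independent (incidence G ∘ edge)
      toward-root       : ∀ x → δ-diff x (root (label x)) ∈Span (incidence G ∘ edge)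
      retired           : Fin r → Fin (n G)
      retired-injective : ∀ l l' → retired l ≡ retired l' → l ≡ l'
      retired≢root      : ∀ l i → retired l ≢ root i
      retired-incident  : ∀ l → Incident G A (retired l)

  open Forest

  trivial-forest : Forest (n G) 0
  trivial-forest = record
    { count             = ℕₚ.+-identityʳ (n G)
    ; label             = λ x → x
    ; root              = λ i → i
    ; label-root        = λ i → refl
    ; label⇒Reach       = λ { x .x refl → here }
    ; edge              = λ ()
    ; edge∈A            = λ ()
    ; edge-joins        = λ ()
    ; edge-injective    = λ ()
    ; edges-independent = λ a _ ()
    ; toward-root       = λ x → combination (λ ()) λ y → ℚₚ.+-inverseʳ (δ x y)
    ; retired           = λ ()
    ; retired-injective = λ ()
    ; retired≢root      = λ ()
    ; retired-incident  = λ ()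
    }

  module Join {k r} (F : Forest (suc k) r) (e : Fin (m G)) (e∈A : e ∈ A)
              (split : label F (src G e) ≢ label F (tgt G e)) where

    s t : Fin (n G)
    s = src G e
    t = tgt G e

    i j : Fin (suc k)
    i = label F s
    j = label F t

    label' : Fin (n G) → Fin k
    label' = merge split ∘ label F

    root' : Fin k → Fin (n G)
    root' = root F ∘ punchIn j

    edge' : Fin (suc r) → Fin (m G)
    edge' = e ∷ edge F

    retired' : Fin (suc r) → Fin (n G)
    retired' = root F j ∷ retired F

    label⇒Reach' : ∀ x y → label' x ≡ label' y → Reach G A x y
    label⇒Reach' x y same with merge-fibre split (label F x) (label F y) same
    ... | inj₁ same-label          = label⇒Reach F x y same-label
    ... | inj₂ (inj₁ (x∈j , y∈i)) = Reach-trans (label⇒Reach F x t x∈j) (step e e∈A (inj₂ (refl , refl)) (label⇒Reach F s y (sym y∈i)))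
    ... | inj₂ (inj₂ (x∈i , y∈j)) = Reach-trans (label⇒Reach F x s x∈i) (step e e∈A (inj₁ (refl , refl)) (label⇒Reach F t y (sym y∈j)))

    edge-joins' : ∀ l → label' (src G (edge' l)) ≡ label' (tgt G (edge' l))
    edge-joins' zero    = merge-identifies split
    edge-joins' (suc l) = cong (merge split) (edge-joins F l)

    e∉forest : ∀ l → e ≢ edge F l
    e∉forest l e≡ = split (subst (λ f → label F (src G f) ≡ label F (tgt G f)) (sym e≡) (edge-joins F l))

    edge-injective' : ∀ l l' → edge' l ≡ edge' l' → l ≡ l'
    edge-injective' zero    zero     _  = refl
    edge-injective' zero    (suc l') e≡ = ⊥-elim (e∉forest l' e≡)
    edge-injective' (suc l) zero     e≡ = ⊥-elim (e∉forest l (sym e≡))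
    edge-injective' (suc l) (suc l') e≡ = cong suc (edge-injective F l l' e≡)

    -- The indicator of the component of s annihilates the forest edges but not e.
    edges-independent' : Independent (incidence G ∘ edge')
    edges-independent' = Independent-extend {c = incidence G ∘ edge'} indicator indicator⊥forest indicator·e≢0 (edges-independent F)
      where
      indicator : Fin (n G) → ℚ
      indicator y = δ (label F y) i
      indicator· : ∀ f → indicator · incidence G f ≡ indicator (src G f) - indicator (tgt G f)
      indicator· f = trans (·-comm indicator (incidence G f)) (incidence-· G f indicator)
      indicator⊥forest : ∀ l → indicator · incidence G (edge F l) ≡ 0ℚ
      indicator⊥forest l = trans (indicator· (edge F l))
        (trans (cong (λ c → δ c i - indicator (tgt G (edge F l))) (edge-joins F l)) (ℚₚ.+-inverseʳ (indicator (tgt G (edge F l)))))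
      indicator·e≢0 : indicator · incidence G e ≢ 0ℚ
      indicator·e≢0 eq = ℚₚ.1≢0 (trans (sym (cong₂ _-_ (δ-refl i) (δ-≢ (split ∘ sym)))) (trans (sym (indicator· e)) eq))

    toward-root' : ∀ x → δ-diff x (root' (label' x)) ∈Span (incidence G ∘ edge')
    toward-root' x = by-component (label F x Fin.≟ j)
      where
      old : ∀ y → δ-diff y (root F (label F y)) ∈Span (incidence G ∘ edge')
      old y = ∈Span-tail (toward-root F y)
      telescope : ∀ x t s ρⱼ ρᵢ → x - ρⱼ - (t - ρⱼ) + (s - ρᵢ) - (s - t) ≡ x - ρᵢ
      telescope = solve-∀ ℚ-ring
      by-component : Dec (label F x ≡ j) → δ-diff x (root' (label' x)) ∈Span (incidence G ∘ edge')
      by-component (no  x∉j) = ∈Span-tail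
        (subst (λ ρ → δ-diff x ρ ∈Span (incidence G ∘ edge F)) (cong (root F) (sym (punchIn-merge-≢ split (label F x) x∉j))) (toward-root F x))
      by-component (yes x∈j) = ∈Span-cong telescoped
        (∈Span-- (∈Span-+ (∈Span-- (old x) (old t)) (old s)) (∈Span-head (incidence G ∘ edge')))
        where
        telescoped : ∀ z → δ-diff x (root F (label F x)) z - δ-diff t (root F j) z + δ-diff s (root F i) z - incidence G e z
                           ≡ δ-diff x (root' (label' x)) z
        telescoped z = begin
          δ-diff x (root F (label F x)) z - δ-diff t (root F j) z + δ-diff s (root F i) z - incidence G e z
            ≡⟨ cong₂ (λ ρ ι → δ x z - δ (root F ρ) z - δ-diff t (root F j) z + δ-diff s (root F i) z - ι) x∈j (incidence≡δ-δ G e z) ⟩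
          δ x z - δ (root F j) z - (δ t z - δ (root F j) z) + (δ s z - δ (root F i) z) - (δ s z - δ t z)
            ≡⟨ telescope (δ x z) (δ t z) (δ s z) (δ (root F j) z) (δ (root F i) z) ⟩
          δ x z - δ (root F i) z
            ≡⟨ cong (λ ρ → δ x z - δ (root F ρ) z) (sym (punchIn-merge-≡ split (label F x) x∈j)) ⟩
          δ-diff x (root' (label' x)) z ∎
          where open ≡-Reasoning

    retired-injective' : ∀ l l' → retired' l ≡ retired' l' → l ≡ l'
    retired-injective' zero    zero     _  = refl
    retired-injective' zero    (suc l') eq = ⊥-elim (retired≢root F l' j (sym eq))
    retired-injective' (suc l) zero     eq = ⊥-elim (retired≢root F l j eq)
    retired-injective' (suc l) (suc l') eq = cong suc (retired-injective F l l' eq)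

    retired≢root' : ∀ l i₀ → retired' l ≢ root' i₀
    retired≢root' zero    i₀ eq = Finₚ.punchInᵢ≢i j i₀
      (sym (trans (sym (label-root F j)) (trans (cong (label F) eq) (label-root F (punchIn j i₀)))))
    retired≢root' (suc l) i₀ = retired≢root F l (punchIn j i₀)

    retired-incident' : ∀ l → Incident G A (retired' l)
    retired-incident' zero with Reach⇒≡⊎Incident (label⇒Reach F (root F j) t (label-root F j))
    ... | inj₁ root≡t  = e , e∈A , inj₂ (sym root≡t)
    ... | inj₂ incident = incident
    retired-incident' (suc l) = retired-incident F l

    joined : Forest k (suc r)
    joined = record
      { count             = trans (ℕₚ.+-suc k r) (count F)
      ; label             = label'
      ; root              = root'
      ; label-root        = λ l → trans (cong (merge split) (label-root F (punchIn j l))) (merge-punchIn split l)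
      ; label⇒Reach       = label⇒Reach'
      ; edge              = edge'
      ; edge∈A            = λ { zero → e∈A ; (suc l) → edge∈A F l }
      ; edge-joins        = edge-joins'
      ; edge-injective    = edge-injective'
      ; edges-independent = edges-independent'
      ; toward-root       = toward-root'
      ; retired           = retired'
      ; retired-injective = retired-injective'
      ; retired≢root      = retired≢root'
      ; retired-incident  = retired-incident'
      }

  record SpanningForest : Set where
    field
      components rank : ℕ
      forest          : Forest components rank
      spanning        : ∀ e → e ∈ A → label forest (src G e) ≡ label forest (tgt G e)

  grow : ∀ {k r} → Forest k r → SpanningForest
  grow {zero}  F = record { forest = F ; spanning = λ e _ → ⊥-elim (Finₚ.¬Fin0 (label F (src G e))) }
  grow {suc k} F with Finₚ.any? (λ e → (e ∈? A) ×-dec ¬? (label F (src G e) Fin.≟ label F (tgt G e)))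
  ... | yes (e , e∈A , split) = grow (Join.joined F e e∈A split)
  ... | no  none              = record
    { forest   = F
    ; spanning = λ e e∈A → decidable-stable (label F (src G e) Fin.≟ label F (tgt G e)) (λ split → none (e , e∈A , split))
    }

  spanning-forest : SpanningForest
  spanning-forest = grow trivial-forest

  module SpanningForestProperties (S : SpanningForest) where
    open SpanningForest S
    F : Forest components rank
    F = forest

    hasComponents : HasComponents G A components
    hasComponents = label F , (λ i → root F i , label-root F i) ,
      λ x y → mk⇔ (label⇒Reach F x y) (Reach-invariant (label F) spanning)

    rank≤m : rank ℕ.≤ m G
    rank≤m = Finₚ.injective⇒≤ (λ {l} {l'} → edge-injective F l l')

    edge-coords : Fin (m G) → Fin rank → ℚ
    edge-coords e = _∈Span_.coeffs (∈Span-- (toward-root F (src G e)) (toward-root F (tgt G e)))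

    incidence-expansion : ∀ e → e ∈ A → ∀ y → incidence G e y ≡ lincomb (edge-coords e) (incidence G ∘ edge F) y
    incidence-expansion e e∈A y = begin
      incidence G e y                                 ≡⟨ incidence≡δ-δ G e y ⟩
      δ (src G e) y - δ (tgt G e) y                   ≡⟨ difference (δ (src G e) y) (δ (tgt G e) y) (δ (root F (label F (src G e))) y) ⟩
      δ-diff (src G e) ρ y - δ-diff (tgt G e) ρ y     ≡⟨ cong (λ i → δ-diff (src G e) ρ y - δ-diff (tgt G e) (root F i) y) (spanning e e∈A) ⟩
      δ-diff (src G e) ρ y - δ-diff (tgt G e) (root F (label F (tgt G e))) y
        ≡⟨ _∈Span_.expansion (∈Span-- (toward-root F (src G e)) (toward-root F (tgt G e))) y ⟩
      lincomb (edge-coords e) (incidence G ∘ edge F) y ∎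
      where
      open ≡-Reasoning
      ρ : Fin (n G)
      ρ = root F (label F (src G e))
      difference : ∀ a b c → a - b ≡ (a - c) - (b - c)
      difference = solve-∀ ℚ-ring

    forest-edge : Fin rank → EdgeA G A
    forest-edge l = edge F l , edge∈A F l

    edgeLap-column∈Span : ∀ e' → (λ e → edgeLap G A e e') ∈Span (λ l e → incidence G (proj₁ e) · (λ x → invDeg G A x * incidence G (edge F l) x))
    edgeLap-column∈Span (e' , e'∈A) = ∈Span-cong (λ (e , e∈A) → sym (edgeLap≡ G A e e∈A e' e'∈A))
      (∈Span-map (incidence G ∘ proj₁) (∈Span-scale (invDeg G A) (combination (edge-coords e') (incidence-expansion e' e'∈A))))

    module ForestEdgeRelation (a : Fin rank → ℚ) (relation : ∀ e → lincomb a (columns (edgeLap G A) forest-edge) e ≡ 0ℚ) where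
      γ : Fin (n G) → ℚ
      γ = lincomb a (incidence G ∘ edge F)

      γ⊥ : ∀ k → incidence G (edge F k) · (λ x → invDeg G A x * γ x) ≡ 0ℚ
      γ⊥ k = begin
        incidence G (edge F k) · (λ x → invDeg G A x * γ x)
          ≡⟨ sum-cong-≗ (λ x → cong (incidence G (edge F k) x *_) (sym (·-*ˡ a (λ l → incidence G (edge F l) x) (invDeg G A x)))) ⟩
        incidence G (edge F k) · lincomb a (λ l x → invDeg G A x * incidence G (edge F l) x)
          ≡⟨ ·-lincomb (incidence G (edge F k)) a _ ⟩
        a · (λ l → incidence G (edge F k) · (λ x → invDeg G A x * incidence G (edge F l) x))
          ≡⟨ sum-cong-≗ (λ l → cong (a l *_) (sym (edgeLap≡ G A (edge F k) (edge∈A F k) (edge F l) (edge∈A F l)))) ⟩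
        lincomb a (columns (edgeLap G A) forest-edge) (forest-edge k)
          ≡⟨ relation (forest-edge k) ⟩
        0ℚ ∎
        where open ≡-Reasoning

      γ≡0 : ∀ x → γ x ≡ 0ℚ
      γ≡0 x with degA G A x ℕ.≟ 0
      ... | yes deg≡0 = trans (sum-cong-≗ (λ l → cong (a l *_) (degree≡0⇒incidence≡0 G A x (edge F l) deg≡0 (edge∈A F l)))) (·-zeroʳ a)
      ... | no  deg≢0 = p*q≡0⇒q≡0 (inv≢0 _ deg≢0) (orthogonal⇒weighted-zero (invDeg G A) a (incidence G ∘ edge F) (0≤inv ∘ degA G A) γ⊥ x)

    edgeLap-rank : HasRank (edgeLap G A) rank
    edgeLap-rank = hasRank (edgeLap G A) forest-edge _
      (λ a relation → edges-independent F a (ForestEdgeRelation.γ≡0 a relation))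
      edgeLap-column∈Span

    retired-vertex : Fin rank → VertA G A
    retired-vertex l = retired F l , retired-incident F l

    weighted-incidence∈Span : ∀ u → (λ e → weight G A e * incidence G e u) ∈Span (λ l e → weight G A e * edge-coords e l)
    weighted-incidence∈Span u = combination (λ l → incidence G (edge F l) u) λ e → begin
      weight G A e * incidence G e u
        ≡⟨ on-A e ⟩
      weight G A e * (edge-coords e · (λ l → incidence G (edge F l) u))
        ≡⟨ cong (weight G A e *_) (·-comm (edge-coords e) _) ⟩
      weight G A e * ((λ l → incidence G (edge F l) u) · edge-coords e)
        ≡⟨ sym (·-*ˡ (λ l → incidence G (edge F l) u) (edge-coords e) (weight G A e)) ⟩
      lincomb (λ l → incidence G (edge F l) u) (λ l e → weight G A e * edge-coords e l) e ∎
      where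
      open ≡-Reasoning
      on-A : ∀ e → weight G A e * incidence G e u ≡ weight G A e * (edge-coords e · (λ l → incidence G (edge F l) u))
      on-A e with lookup A e in e∈?
      ... | true  = cong (1ℚ *_) (incidence-expansion e (Vecₚ.lookup⇒[]= e A e∈?) u)
      ... | false = trans (ℚₚ.*-zeroˡ (incidence G e u)) (sym (ℚₚ.*-zeroˡ (edge-coords e · (λ l → incidence G (edge F l) u))))

    normLap-column∈Span : ∀ u → (λ v → normLap G A v u) ∈Span (λ l v → (λ e → invDeg G A (proj₁ v) * incidence G e (proj₁ v)) · (λ e → weight G A e * edge-coords e l))
    normLap-column∈Span (u , u∈) = ∈Span-cong (λ (v , v∈) → sym (normLap≡ G A v v∈ u u∈))
      (∈Span-map (λ v e → invDeg G A (proj₁ v) * incidence G e (proj₁ v)) (weighted-incidence∈Span u))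

    module RetiredRelation (a : Fin rank → ℚ) (relation : ∀ v → lincomb a (columns (normLap G A) retired-vertex) v ≡ 0ℚ) where
      φ : Fin (m G) → ℚ
      φ = lincomb a (λ l e → incidence G e (retired F l))

      α : Fin (n G) → ℚ
      α = lincomb a (λ l x → δ x (retired F l))

      φ⊥ : ∀ k → (λ e → incidence G e (retired F k)) · (λ e → weight G A e * φ e) ≡ 0ℚ
      φ⊥ k = p*q≡0⇒q≡0 (inv≢0 _ (Incident⇒degree≢0 G A _ (retired-incident F k))) (begin
        d * (Uₖ · (λ e → weight G A e * φ e))
          ≡⟨ sym (trans (·-comm (λ e → d * Uₖ e) wφ) (trans (·-*ˡ wφ Uₖ d) (cong (d *_) (·-comm wφ Uₖ)))) ⟩
        (λ e → d * Uₖ e) · (λ e → weight G A e * φ e)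
          ≡⟨ sum-cong-≗ (λ e → cong (d * Uₖ e *_) (sym (·-*ˡ a (λ l → incidence G e (retired F l)) (weight G A e)))) ⟩
        (λ e → d * Uₖ e) · lincomb a (λ l e → weight G A e * incidence G e (retired F l))
          ≡⟨ ·-lincomb (λ e → d * Uₖ e) a _ ⟩
        a · (λ l → (λ e → d * Uₖ e) · (λ e → weight G A e * incidence G e (retired F l)))
          ≡⟨ sum-cong-≗ (λ l → cong (a l *_) (sym (normLap≡ G A _ (retired-incident F k) _ (retired-incident F l)))) ⟩
        lincomb a (columns (normLap G A) retired-vertex) (retired-vertex k)
          ≡⟨ relation (retired-vertex k) ⟩
        0ℚ ∎)
        where
        open ≡-Reasoning
        d : ℚ
        d = invDeg G A (retired F k)
        Uₖ wφ : Fin (m G) → ℚ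
        Uₖ e = incidence G e (retired F k)
        wφ e = weight G A e * φ e

      φ≡α-α : ∀ e → φ e ≡ α (src G e) - α (tgt G e)
      φ≡α-α e = trans (sum-cong-≗ (λ l → cong (a l *_) (incidence≡δ-δ G e (retired F l))))
                      (·-distrib-- a (λ l → δ (src G e) (retired F l)) (λ l → δ (tgt G e) (retired F l)))

      α-joins : ∀ e → e ∈ A → α (src G e) ≡ α (tgt G e)
      α-joins e e∈A = p-q≡0⇒p≡q (trans (sym (φ≡α-α e)) φₑ≡0)
        where
        φₑ≡0 : φ e ≡ 0ℚ
        φₑ≡0 = trans (sym (ℚₚ.*-identityˡ (φ e)))
          (trans (cong (λ b → ind b * φ e) (sym (Vecₚ.[]=⇒lookup e∈A)))
            (orthogonal⇒weighted-zero (weight G A) a (λ l e → incidence G e (retired F l)) (0≤ind ∘ lookup A) φ⊥ e))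

      α-retired : ∀ k → α (retired F k) ≡ a k
      α-retired k = trans (sum-cong-≗ (λ l → trans (cong (a l *_) (δ-retired l)) (ℚₚ.*-comm (a l) (δ k l)))) (∑-δ k a)
        where
        δ-retired : ∀ l → δ (retired F k) (retired F l) ≡ δ k l
        δ-retired l with k Fin.≟ l
        ... | yes refl = δ-refl (retired F k)
        ... | no  k≢l  = δ-≢ (k≢l ∘ retired-injective F k l)

      α-root : ∀ i → α (root F i) ≡ 0ℚ
      α-root i = trans (sum-cong-≗ (λ l → cong (a l *_) (δ-≢ (retired≢root F l i ∘ sym)))) (·-zeroʳ a)

      a≡0 : ∀ k → a k ≡ 0ℚ
      a≡0 k = begin
        a k                                   ≡⟨ sym (α-retired k) ⟩
        α (retired F k)                       ≡⟨ Reach-invariant α α-joins (label⇒Reach F _ _ (sym (label-root F (label F (retired F k))))) ⟩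
        α (root F (label F (retired F k)))    ≡⟨ α-root (label F (retired F k)) ⟩
        0ℚ                                    ∎
        where open ≡-Reasoning

    normLap-rank : HasRank (normLap G A) rank
    normLap-rank = hasRank (normLap G A) retired-vertex _ RetiredRelation.a≡0 normLap-column∈Span

-- The density inequality

x-y≤x-z⇔z≤y : ∀ x y z → (x ℤ.- y ℤ.≤ x ℤ.- z) ⇔ (z ℤ.≤ y)
x-y≤x-z⇔z≤y x y z = mk⇔
  (λ le → ℤₚ.neg-cancel-≤ (subst₂ ℤ._≤_ (cancel x y) (cancel x z) (ℤₚ.+-monoʳ-≤ (ℤ.- x) le)))
  (λ z≤y → ℤₚ.+-monoʳ-≤ x (ℤₚ.neg-mono-≤ z≤y))
  where
  cancel : ∀ x y → ℤ.- x ℤ.+ (x ℤ.- y) ≡ ℤ.- y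
  cancel = ℤ-solve

density-ℤ : ∀ a E R M → (a ℕ.* E ℕ.≤ M ℕ.* R) ⇔ ((ℤ.+ E ℤ.- ℤ.+ R) ℤ.* ℤ.+ M ℤ.≤ (ℤ.+ M ℤ.- ℤ.+ a) ℤ.* ℤ.+ E)
density-ℤ a E R M = ⇔-trans (mk⇔ ℤ.+≤+ ℤₚ.drop‿+≤+)
  (⇔-trans (⇔-sym (x-y≤x-z⇔z≤y (ℤ.+ E ℤ.* ℤ.+ M) (ℤ.+ (M ℕ.* R)) (ℤ.+ (a ℕ.* E))))
    (mk⇔ (subst₂ ℤ._≤_ (sym lhs) (sym rhs)) (subst₂ ℤ._≤_ lhs rhs)))
  where
  expandˡ : ∀ E R M → (E ℤ.- R) ℤ.* M ≡ E ℤ.* M ℤ.- M ℤ.* R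
  expandˡ = ℤ-solve
  expandʳ : ∀ E a M → (M ℤ.- a) ℤ.* E ≡ E ℤ.* M ℤ.- a ℤ.* E
  expandʳ = ℤ-solve
  lhs : (ℤ.+ E ℤ.- ℤ.+ R) ℤ.* ℤ.+ M ≡ ℤ.+ E ℤ.* ℤ.+ M ℤ.- ℤ.+ (M ℕ.* R)
  lhs = trans (expandˡ (ℤ.+ E) (ℤ.+ R) (ℤ.+ M)) (cong (λ x → ℤ.+ E ℤ.* ℤ.+ M ℤ.- x) (sym (ℤₚ.pos-* M R)))
  rhs : (ℤ.+ M ℤ.- ℤ.+ a) ℤ.* ℤ.+ E ≡ ℤ.+ E ℤ.* ℤ.+ M ℤ.- ℤ.+ (a ℕ.* E)
  rhs = trans (expandʳ (ℤ.+ E) (ℤ.+ a) (ℤ.+ M)) (cong (λ x → ℤ.+ E ℤ.* ℤ.+ M ℤ.- x) (sym (ℤₚ.pos-* a E)))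

density-∸ : ∀ a E R M → E ℕ.≤ M → (a ℕ.* E ℕ.≤ M ℕ.* R) ⇔ ((a ∸ R) ℕ.* M ℕ.≤ (M ∸ E) ℕ.* a)
density-∸ a E R M E≤M = mk⇔ to from
  where
  lhs : (a ∸ R) ℕ.* M ≡ a ℕ.* M ∸ R ℕ.* M
  lhs = ℕₚ.*-distribʳ-∸ M a R
  rhs : (M ∸ E) ℕ.* a ≡ a ℕ.* M ∸ E ℕ.* a
  rhs = trans (ℕₚ.*-distribʳ-∸ a M E) (cong (ℕ._∸ E ℕ.* a) (ℕₚ.*-comm M a))
  to : a ℕ.* E ℕ.≤ M ℕ.* R → (a ∸ R) ℕ.* M ℕ.≤ (M ∸ E) ℕ.* a
  to aE≤MR = subst₂ ℕ._≤_ (sym lhs) (sym rhs) (ℕₚ.∸-monoʳ-≤ (a ℕ.* M) Ea≤RM)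
    where
    open ℕₚ.≤-Reasoning
    Ea≤RM : E ℕ.* a ℕ.≤ R ℕ.* M
    Ea≤RM = begin
      E ℕ.* a  ≡⟨ ℕₚ.*-comm E a ⟩
      a ℕ.* E  ≤⟨ aE≤MR ⟩
      M ℕ.* R  ≡⟨ ℕₚ.*-comm M R ⟩
      R ℕ.* M  ∎
  from : (a ∸ R) ℕ.* M ℕ.≤ (M ∸ E) ℕ.* a → a ℕ.* E ℕ.≤ M ℕ.* R
  from le = subst₂ ℕ._≤_ (ℕₚ.*-comm E a) (ℕₚ.*-comm R M) (ℕₚ.∸-cancelʳ-≤ Ea≤aM (subst₂ ℕ._≤_ lhs rhs le))
    where
    Ea≤aM : E ℕ.* a ℕ.≤ a ℕ.* M
    Ea≤aM = ℕₚ.≤-trans (ℕₚ.*-monoˡ-≤ a E≤M) (ℕₚ.≤-reflexive (ℕₚ.*-comm M a))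

module _ (G : Graph) where

  module Spanning (A : EdgeSet G) = SpanningForestProperties G A (spanning-forest G A)

  rank : EdgeSet G → ℕ
  rank A = SpanningForest.rank (spanning-forest G A)

  mrank≡rank : ∀ A {c} → HasComponents G A c → mrank G c ≡ rank A
  mrank≡rank A {c} hc = begin
    n G ∸ c                   ≡⟨ cong (n G ∸_) (HasComponents-unique hc (Spanning.hasComponents A)) ⟩
    n G ∸ k                   ≡⟨ cong (_∸ k) (sym (Forest.count (SpanningForest.forest (spanning-forest G A)))) ⟩
    k ℕ.+ rank A ∸ k          ≡⟨ ℕₚ.m+n∸m≡n k (rank A) ⟩
    rank A                    ∎
    where
    open ≡-Reasoning
    k : ℕ
    k = SpanningForest.components (spanning-forest G A)

  DensityBound : Set
  DensityBound = ∀ A → Nonempty A → ∣ A ∣ ℕ.* rank ⊤ ℕ.≤ m G ℕ.* rank A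

  UniformlyDense⇔DensityBound : UniformlyDense G ⇔ DensityBound
  UniformlyDense⇔DensityBound = mk⇔
    (λ dense A A≢∅ → subst₂ (λ x y → ∣ A ∣ ℕ.* x ℕ.≤ m G ℕ.* y) (mrank≡rank ⊤ (Spanning.hasComponents ⊤)) (mrank≡rank A (Spanning.hasComponents A))
      (dense A A≢∅ _ _ (Spanning.hasComponents A) (Spanning.hasComponents ⊤)))
    (λ bound A A≢∅ cA cE hA hE → subst₂ (λ x y → ∣ A ∣ ℕ.* x ℕ.≤ m G ℕ.* y) (sym (mrank≡rank ⊤ hE)) (sym (mrank≡rank A hA)) (bound A A≢∅))

  Cond2⇔DensityBound : Cond2 G ⇔ DensityBound
  Cond2⇔DensityBound = mk⇔ to from
    where
    Cond2-at : EdgeSet G → ℕ → ℕ → ℕ → Set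
    Cond2-at A rE rA E = (ℤ.+ rE ℤ.- ℤ.+ rA) ℤ.* ℤ.+ m G ℤ.≤ (ℤ.+ m G ℤ.- ℤ.+ ∣ A ∣) ℤ.* ℤ.+ E
    to : Cond2 G → DensityBound
    to cond A A≢∅ = Equivalence.from (density-ℤ ∣ A ∣ (rank ⊤) (rank A) (m G))
      (subst (Cond2-at A (rank ⊤) (rank A)) (mrank≡rank ⊤ (Spanning.hasComponents ⊤))
        (cond A A≢∅ (rank ⊤) (rank A) (SpanningForest.components (spanning-forest G ⊤)) (Spanning.normLap-rank ⊤) (Spanning.normLap-rank A) (Spanning.hasComponents ⊤)))
    from : DensityBound → Cond2 G
    from bound A A≢∅ rE rA cE hE hA hc =
      subst₂ (λ x y → Cond2-at A x y (mrank G cE)) (rank-unique (normLap G ⊤) (Spanning.normLap-rank ⊤) hE) (rank-unique (normLap G A) (Spanning.normLap-rank A) hA)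
        (subst (Cond2-at A (rank ⊤) (rank A)) (sym (mrank≡rank ⊤ hc))
          (Equivalence.to (density-ℤ ∣ A ∣ (rank ⊤) (rank A) (m G)) (bound A A≢∅)))

  Cond3⇔DensityBound : Cond3 G ⇔ DensityBound
  Cond3⇔DensityBound = mk⇔ to from
    where
    Cond3-at : EdgeSet G → ℕ → ℕ → Set
    Cond3-at A rE rA = (∣ A ∣ ∸ rA) ℕ.* m G ℕ.≤ (m G ∸ rE) ℕ.* ∣ A ∣
    density : ∀ A → (∣ A ∣ ℕ.* rank ⊤ ℕ.≤ m G ℕ.* rank A) ⇔ Cond3-at A (rank ⊤) (rank A)
    density A = density-∸ ∣ A ∣ (rank ⊤) (rank A) (m G) (Spanning.rank≤m ⊤)
    to : Cond3 G → DensityBound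
    to cond A A≢∅ = Equivalence.from (density A) (cond A A≢∅ (rank ⊤) (rank A) (Spanning.edgeLap-rank ⊤) (Spanning.edgeLap-rank A))
    from : DensityBound → Cond3 G
    from bound A A≢∅ rE rA hE hA =
      subst₂ (Cond3-at A) (rank-unique (edgeLap G ⊤) (Spanning.edgeLap-rank ⊤) hE) (rank-unique (edgeLap G A) (Spanning.edgeLap-rank A) hA)
        (Equivalence.to (density A) (bound A A≢∅))

-- With no edges all three conditions hold vacuously.
theorem3p15 : (G : Graph) → m G ≥ 1 →
    (UniformlyDense G ⇔ Cond2 G) × (Cond2 G ⇔ Cond3 G)
theorem3p15 G _ =
  ⇔-trans (UniformlyDense⇔DensityBound G) (⇔-sym (Cond2⇔DensityBound G)) ,
  ⇔-trans (Cond2⇔DensityBound G) (⇔-sym (Cond3⇔DensityBound G))
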